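{- Every weak partition tautology is a subset tautology.
   Context: Formulas are built from atomic variables and constants $0,1$ with binary connectives $\vee,\wedge,\Rightarrow,\mid$. Subset semantics: for a nonempty set $U$, assign subsets of $U$ to the variables, $0=\emptyset$, $1=U$, $\vee=\cup$, $\wedge=\cap$, $A\Rightarrow B=(U\setminus A)\cup B$, $A\mid B=U\setminus(A\cap B)$; a subset tautology is a formula evaluating to $U$ for every nonempty $U$ and every assignment. Partition semantics: for a set $U$ with $|U|\ge 2$, assign partitions on $U$ (sets of nonempty pairwise disjoint blocks with union $U$) to the variables; with $\operatorname{dit}(\pi)$ the set of ordered pairs in different blocks, $\operatorname{indit}(\pi)$ its complement, $\overline S$ the smallest equivalence relation containing $S\subseteq U\times U$ and $\operatorname{int}(S)=U\times U\setminus\overline{U\times U\setminus S}$: $0=\{U\}$, $1$ = discrete partition, $\operatorname{dit}(\sigma\vee\tau)=\operatorname{dit}\sigma\cup\operatorname{dit}\tau$, $\operatorname{dit}(\sigma\wedge\tau)=\operatorname{int}(\operatorname{dit}\sigma\cap\operatorname{dit}\tau)$, $\operatorname{dit}(\sigma\Rightarrow\tau)=\operatorname{int}((U\times U\setminus\operatorname{dit}\sigma)\cup\operatorname{dit}\tau)$, $\operatorname{dit}(\sigma\mid\tau)=\operatorname{int}(\operatorname{indit}\sigma\cup\operatorname{indit}\tau)$. A weak partition tautology is a formula that never evaluates to the partition $0$, for any $U$ with $|U|\ge2$ and any assignment. -}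

module Defs where

open import Level using (0ℓ)
open import Data.Nat using (ℕ)
open import Data.Bool using (Bool; true; false; _∧_; _∨_; not)
open import Data.Product using (Σ; Σ-syntax; _×_; _,_; proj₁)
open import Data.Sum using (_⊎_)
open import Data.Unit using (⊤)
open import Relation.Nullary using (¬_)
open import Relation.Binary.Core using (Rel)
open import Relation.Binary.Structures using (IsEquivalence)
open import Relation.Binary.PropositionalEquality using (_≡_)
open import Relation.Binary.Construct.Closure.Equivalence using (EqClosure)

data Formula : Set where
  var  : ℕ → Formula
  𝟘 𝟙  : Formula
  _∨ᶠ_ _∧ᶠ_ _⇒ᶠ_ _∣ᶠ_ : Formula → Formula → Formula

Subset : Set → Set
Subset U = U → Bool

⟦_⟧ˢ : {U : Set} → Formula → (ℕ → Subset U) → Subset U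
⟦ var n ⟧ˢ ρ u = ρ n u
⟦ 𝟘 ⟧ˢ ρ u = false
⟦ 𝟙 ⟧ˢ ρ u = true
⟦ φ ∨ᶠ ψ ⟧ˢ ρ u = ⟦ φ ⟧ˢ ρ u ∨ ⟦ ψ ⟧ˢ ρ u
⟦ φ ∧ᶠ ψ ⟧ˢ ρ u = ⟦ φ ⟧ˢ ρ u ∧ ⟦ ψ ⟧ˢ ρ u
⟦ φ ⇒ᶠ ψ ⟧ˢ ρ u = not (⟦ φ ⟧ˢ ρ u) ∨ ⟦ ψ ⟧ˢ ρ u
⟦ φ ∣ᶠ ψ ⟧ˢ ρ u = not (⟦ φ ⟧ˢ ρ u ∧ ⟦ ψ ⟧ˢ ρ u)

SubsetTautology : Formula → Set₁
SubsetTautology φ =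
  (U : Set) → U → (ρ : ℕ → Subset U) → (u : U) → ⟦ φ ⟧ˢ ρ u ≡ true

-- Partition semantics.  A partition on U is represented by its
-- equivalence relation  indit(π)  ("same block").

Partition : Set → Set₁
Partition U = Σ (Rel U 0ℓ) IsEquivalence

indit : {U : Set} → Partition U → Rel U 0ℓ
indit = proj₁

∁ : {U : Set} → Rel U 0ℓ → Rel U 0ℓ
∁ S a b = ¬ S a b

_∪ʳ_ : {U : Set} → Rel U 0ℓ → Rel U 0ℓ → Rel U 0ℓ
(S ∪ʳ T) a b = S a b ⊎ T a b

_∩ʳ_ : {U : Set} → Rel U 0ℓ → Rel U 0ℓ → Rel U 0ℓ
(S ∩ʳ T) a b = S a b × T a b

closure : {U : Set} → Rel U 0ℓ → Rel U 0ℓ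
closure S = EqClosure S

int : {U : Set} → Rel U 0ℓ → Rel U 0ℓ
int S = ∁ (closure (∁ S))

-- The value of a formula, given as its ditset.
dit⟦_⟧ : {U : Set} → Formula → (ℕ → Partition U) → Rel U 0ℓ
dit⟦ var n ⟧ ρ = ∁ (indit (ρ n))
dit⟦ 𝟘 ⟧ ρ = λ _ _ → ¬ ⊤                         -- 0 = {U}: no distinctions
dit⟦ 𝟙 ⟧ ρ = λ a b → ¬ (a ≡ b)                   -- 1 = discrete partition
dit⟦ φ ∨ᶠ ψ ⟧ ρ = dit⟦ φ ⟧ ρ ∪ʳ dit⟦ ψ ⟧ ρ
dit⟦ φ ∧ᶠ ψ ⟧ ρ = int (dit⟦ φ ⟧ ρ ∩ʳ dit⟦ ψ ⟧ ρ)
dit⟦ φ ⇒ᶠ ψ ⟧ ρ = int (∁ (dit⟦ φ ⟧ ρ) ∪ʳ dit⟦ ψ ⟧ ρ)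
dit⟦ φ ∣ᶠ ψ ⟧ ρ = int (∁ (dit⟦ φ ⟧ ρ) ∪ʳ ∁ (dit⟦ ψ ⟧ ρ))

IsZero : {U : Set} → Rel U 0ℓ → Set
IsZero {U} D = (a b : U) → ¬ D a b

WeakPartitionTautology : Formula → Set₁
WeakPartitionTautology φ =
  (U : Set) → (Σ[ a ∈ U ] Σ[ b ∈ U ] ¬ (a ≡ b)) → (ρ : ℕ → Partition U) →
  ¬ IsZero (dit⟦ φ ⟧ ρ)

module Submission where

-- A subset-semantics counterexample at a point u is a Boolean valuation.
-- Interpret each variable by the discrete partition 1 or the indiscrete
-- partition 0 on a two-element set, according to its truth value at u.
-- On pairs of distinct elements the ditset operations then compute exactly
-- the Boolean operations (the interior is harmless because the relevant
-- relations either contain or avoid every distinct pair), so a formula false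
-- at u evaluates to the partition 0.

open import Level using (0ℓ)
open import Data.Bool using (Bool; true; false; _∧_; _∨_; not)
open import Data.Bool.Properties using (∨-∧-booleanAlgebra)
open import Algebra.Lattice.Properties.BooleanAlgebra ∨-∧-booleanAlgebra using (deMorgan₁)
open import Data.Nat using (ℕ)
open import Data.Product using (_,_; proj₁; proj₂)
open import Data.Sum using (inj₁; inj₂; [_,_])
open import Data.Unit using (⊤; tt)
open import Data.Empty using (⊥-elim)
open import Function using (_∘_)
open import Relation.Nullary using (¬_; yes; no)
open import Relation.Nullary.Decidable using (¬¬-excluded-middle)
open import Relation.Binary.Core using (Rel)
open import Relation.Binary.Definitions using (Irreflexive)
open import Relation.Binary.Structures using (IsEquivalence)
open import Relation.Binary.PropositionalEquality
  using (_≡_; _≢_; refl; sym; trans; subst; isEquivalence)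
open import Relation.Binary.Construct.Closure.ReflexiveTransitive using (ε)
open import Relation.Binary.Construct.Closure.Equivalence using (fold; return)

open import Defs

module _ {V : Set} where

  discrete indiscrete : Partition V
  discrete = _≡_ , isEquivalence
  indiscrete = (λ _ _ → ⊤) , record { refl = tt ; sym = λ _ → tt ; trans = λ _ _ → tt }

  boolPartition : Bool → Partition V
  boolPartition true = discrete
  boolPartition false = indiscrete

  -- D agrees with the ditset of 1 (true) or of 0 (false) off the diagonal.
  Distinguishes : Bool → Rel V 0ℓ → Set
  Distinguishes true D = ∀ {x y} → x ≢ y → D x y
  Distinguishes false D = ∀ {x y} → x ≢ y → ¬ D x y

  boolPartition-distinguishes : ∀ b → Distinguishes b (∁ (indit (boolPartition b)))
  boolPartition-distinguishes true x≢y = x≢y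
  boolPartition-distinguishes false _ ¬⊤ = ¬⊤ tt

  ∁-distinguishes : ∀ {b D} → Distinguishes b D → Distinguishes (not b) (∁ D)
  ∁-distinguishes {true} d x≢y ¬D = ¬D (d x≢y)
  ∁-distinguishes {false} d = d

  ∪-distinguishes : ∀ {a b D E} → Distinguishes a D → Distinguishes b E →
                    Distinguishes (a ∨ b) (D ∪ʳ E)
  ∪-distinguishes {true} d e x≢y = inj₁ (d x≢y)
  ∪-distinguishes {false} {true} d e x≢y = inj₂ (e x≢y)
  ∪-distinguishes {false} {false} d e x≢y = [ d x≢y , e x≢y ]

  ∩-distinguishes : ∀ {a b D E} → Distinguishes a D → Distinguishes b E →
                    Distinguishes (a ∧ b) (D ∩ʳ E)
  ∩-distinguishes {true} {true} d e x≢y = d x≢y , e x≢y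
  ∩-distinguishes {true} {false} d e x≢y = e x≢y ∘ proj₂
  ∩-distinguishes {false} d e x≢y = d x≢y ∘ proj₁

  ¬¬≡-isEquivalence : IsEquivalence (λ (x y : V) → ¬ ¬ x ≡ y)
  ¬¬≡-isEquivalence = record
    { refl = λ x≢x → x≢x refl
    ; sym = λ ¬¬x≡y y≢x → ¬¬x≡y (y≢x ∘ sym)
    ; trans = λ ¬¬x≡y ¬¬y≡z x≢z → ¬¬x≡y λ x≡y → ¬¬y≡z (x≢z ∘ trans x≡y)
    }

  -- If S contains every distinct pair, the complement of S lies in the
  -- (double-negated) diagonal, and so does its equivalence closure.
  int-distinguishes : ∀ {b S} → Distinguishes b S → Distinguishes b (int S)
  int-distinguishes {true} s x≢y =
    λ c → fold ¬¬≡-isEquivalence (λ ¬S u≢v → ¬S (s u≢v)) c x≢y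
  int-distinguishes {false} s x≢y ¬c = ¬c (return (s x≢y))

  int-irreflexive : (S : Rel V 0ℓ) → Irreflexive _≡_ (int S)
  int-irreflexive S refl ¬c = ¬c ε

  dit-irreflexive : (φ : Formula) (ρ : ℕ → Partition V) →
                    Irreflexive _≡_ (dit⟦ φ ⟧ ρ)
  dit-irreflexive (var n) ρ refl ¬indit = ¬indit (IsEquivalence.refl (proj₂ (ρ n)))
  dit-irreflexive 𝟘 ρ _ ¬⊤ = ¬⊤ tt
  dit-irreflexive 𝟙 ρ refl x≢x = x≢x refl
  dit-irreflexive (φ ∨ᶠ ψ) ρ x≡y = [ dit-irreflexive φ ρ x≡y , dit-irreflexive ψ ρ x≡y ]
  dit-irreflexive (φ ∧ᶠ ψ) ρ = int-irreflexive _
  dit-irreflexive (φ ⇒ᶠ ψ) ρ = int-irreflexive _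
  dit-irreflexive (φ ∣ᶠ ψ) ρ = int-irreflexive _

  distinguishes-false⇒isZero : ∀ {D} → Irreflexive _≡_ D →
                               Distinguishes false D → IsZero D
  distinguishes-false⇒isZero irr d x y Dxy = ¬¬-excluded-middle λ
    { (yes x≡y) → irr x≡y Dxy
    ; (no x≢y) → d x≢y Dxy
    }

  dit-distinguishes : {U : Set} (ρ : ℕ → Subset U) (u : U) (φ : Formula) →
                      Distinguishes (⟦ φ ⟧ˢ ρ u) (dit⟦ φ ⟧ λ n → boolPartition (ρ n u))
  dit-distinguishes ρ u (var n) = boolPartition-distinguishes (ρ n u)
  dit-distinguishes ρ u 𝟘 _ ¬⊤ = ¬⊤ tt
  dit-distinguishes ρ u 𝟙 x≢y = x≢y
  dit-distinguishes ρ u (φ ∨ᶠ ψ) =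
    ∪-distinguishes (dit-distinguishes ρ u φ) (dit-distinguishes ρ u ψ)
  dit-distinguishes ρ u (φ ∧ᶠ ψ) =
    int-distinguishes (∩-distinguishes (dit-distinguishes ρ u φ) (dit-distinguishes ρ u ψ))
  dit-distinguishes ρ u (φ ⇒ᶠ ψ) =
    int-distinguishes (∪-distinguishes (∁-distinguishes (dit-distinguishes ρ u φ))
                                       (dit-distinguishes ρ u ψ))
  dit-distinguishes ρ u (φ ∣ᶠ ψ) =
    subst (λ b → Distinguishes b _) (sym (deMorgan₁ (⟦ φ ⟧ˢ ρ u) (⟦ ψ ⟧ˢ ρ u)))
      (int-distinguishes (∪-distinguishes (∁-distinguishes (dit-distinguishes ρ u φ))
                                          (∁-distinguishes (dit-distinguishes ρ u ψ))))

mainTheorem8 : (φ : Formula) → WeakPartitionTautology φ → SubsetTautology φ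
mainTheorem8 φ weak U _ ρ u with ⟦ φ ⟧ˢ ρ u | dit-distinguishes ρ u φ
... | true | _ = refl
... | false | d = ⊥-elim (weak Bool (true , false , λ ()) σ
                    (distinguishes-false⇒isZero (dit-irreflexive φ σ) d))
  where σ = λ n → boolPartition (ρ n u)
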